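{- Let $X$ be a directed space. Then $X$ is a continuous space (resp. an algebraic space) iff $\widetilde{X}$ is a continuous (resp. algebraic) dcpo.
   Context: Spaces are $T_0$ with specialization order $x\sqsubseteq y$ iff $x\in\overline{\{y\}}$; a directed $D$ converges to $x$ ($D\to x$) if it meets every open neighbourhood of $x$. A directed space is a $T_0$ space in which every set $U$ such that "for every directed $D$ and $x\in U$ with $D\to x$, $D\cap U\neq\emptyset$" is open. In a directed space, $x\ll y$ iff for every directed $D$ with $D\to y$, $D\cap{\uparrow}x\neq\emptyset$; $x$ is compact if $x\ll x$. A directed space $X$ is continuous if for every $x$ the set $\{a: a\ll x\}$ is directed and converges to $x$; it is algebraic if for every $x$ the set $\{a: a\ll a,\ a\sqsubseteq x\}$ is directed and converges to $x$. $\widetilde{X}$ is the d-closure of $\{{\downarrow}x:x\in X\}$ inside the dcpo $\Gamma(X)$ of nonempty closed subsets of $X$ ordered by inclusion (the smallest superset closed under existing directed suprema); it is a dcpo under inclusion. -}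

module Defs where

open import Level using (Level; _⊔_; 0ℓ) renaming (suc to lsuc)
open import Data.Product using (Σ; _×_; _,_; proj₁; proj₂; ∃; ∃-syntax)
open import Data.Unit using (⊤)
open import Relation.Nullary using (¬_)
open import Relation.Unary using (Pred; _⊆_)
open import Relation.Binary.PropositionalEquality using (_≡_)

-- Closure under arbitrary unions is expressed predicatively by the
-- neighbourhood criterion: V is open as soon as every point of V has an
-- open neighbourhood contained in V.

record Space : Set₁ where
  field
    Carrier    : Set
    -- the topology, as a family of subsets indexed by a (small) type
    OpenIdx    : Set
    ⟦_⟧        : OpenIdx → Pred Carrier 0ℓ

  Open : Pred Carrier 0ℓ → Set
  Open V = ∃[ i ] (⟦ i ⟧ ⊆ V × V ⊆ ⟦ i ⟧)

  field
    open-univ  : Open (λ _ → ⊤)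
    open-∩     : ∀ {U V} → Open U → Open V → Open (λ x → U x × V x)
    open-local : (V : Pred Carrier 0ℓ) →
                 (∀ x → V x → Σ (Pred Carrier 0ℓ) λ U → Open U × U x × U ⊆ V) →
                 Open V

module SpaceNotions (X : Space) where
  open Space X

  closure : ∀ {ℓ} → Pred Carrier ℓ → Pred Carrier ℓ
  closure A x = ∀ (i : OpenIdx) → ⟦ i ⟧ x → ∃[ a ] (A a × ⟦ i ⟧ a)

  _⊑_ : Carrier → Carrier → Set
  x ⊑ y = closure (λ z → z ≡ y) x

  ↓ : Carrier → Pred Carrier 0ℓ
  ↓ x = λ y → y ⊑ x

  ↑ : Carrier → Pred Carrier 0ℓ
  ↑ x = λ y → x ⊑ y

  T0 : Set
  T0 = ∀ x y → (∀ (i : OpenIdx) → (⟦ i ⟧ x → ⟦ i ⟧ y) × (⟦ i ⟧ y → ⟦ i ⟧ x)) → x ≡ y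

  Directed : ∀ {ℓ} → Pred Carrier ℓ → Set ℓ
  Directed D = (∃[ d ] D d) ×
               (∀ a b → D a → D b → ∃[ c ] (D c × a ⊑ c × b ⊑ c))

  Converges : ∀ {ℓ} → Pred Carrier ℓ → Carrier → Set ℓ
  Converges D x = ∀ (i : OpenIdx) → ⟦ i ⟧ x → ∃[ d ] (D d × ⟦ i ⟧ d)

  IsDirectedSpace : Set₁
  IsDirectedSpace =
    T0 ×
    (∀ (U : Pred Carrier 0ℓ) →
       (∀ (D : Pred Carrier 0ℓ) → Directed D → ∀ x → U x → Converges D x →
          ∃[ d ] (D d × U d)) →
       Open U)

  _≪_ : Carrier → Carrier → Set₁
  x ≪ y = ∀ (D : Pred Carrier 0ℓ) → Directed D → Converges D y →
          ∃[ d ] (D d × ↑ x d)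

  Compact : Carrier → Set₁
  Compact x = x ≪ x

  ContinuousSpace : Set₁
  ContinuousSpace = ∀ x → Directed (λ a → a ≪ x) × Converges (λ a → a ≪ x) x

  AlgebraicSpace : Set₁
  AlgebraicSpace = ∀ x → Directed (λ a → Compact a × a ⊑ x) ×
                         Converges (λ a → Compact a × a ⊑ x) x

  IsClosed : Pred Carrier 0ℓ → Set
  IsClosed C = Open (λ x → ¬ C x)

  InΓ : Pred Carrier 0ℓ → Set
  InΓ C = IsClosed C × ∃[ x ] C x

  DirectedΓ : ∀ {ℓ} → Pred (Pred Carrier 0ℓ) ℓ → Set (lsuc 0ℓ ⊔ ℓ)
  DirectedΓ 𝒟 = (∀ A → 𝒟 A → InΓ A) ×
                (∃[ A ] 𝒟 A) ×
                (∀ A B → 𝒟 A → 𝒟 B → ∃[ C ] (𝒟 C × A ⊆ C × B ⊆ C))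

  IsSupΓ : ∀ {ℓ} → Pred (Pred Carrier 0ℓ) ℓ → Pred Carrier 0ℓ → Set (lsuc 0ℓ ⊔ ℓ)
  IsSupΓ 𝒟 S = InΓ S × (∀ A → 𝒟 A → A ⊆ S) ×
               (∀ C → InΓ C → (∀ A → 𝒟 A → A ⊆ C) → S ⊆ C)

  -- X̃: the d-closure of {↓x | x ∈ X} in Γ(X), i.e. the least collection
  -- containing all ↓x and closed under (existing) suprema in Γ(X) of
  -- directed subfamilies of itself.
  data InTilde : Pred (Pred Carrier 0ℓ) (lsuc 0ℓ) where
    principal : ∀ x → InTilde (↓ x)
    dirsup    : (𝒟 : Pred (Pred Carrier 0ℓ) 0ℓ) → DirectedΓ 𝒟 →
                (∀ A → 𝒟 A → InTilde A) →
                ∀ S → IsSupΓ 𝒟 S → InTilde S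

  Tilde : Set₁
  Tilde = Σ (Pred Carrier 0ℓ) InTilde

  _⊆̃_ : Tilde → Tilde → Set
  A ⊆̃ B = proj₁ A ⊆ proj₁ B

module DcpoNotions {a r : Level} {A : Set a} (_≤_ : A → A → Set r) (ℓ : Level) where

  DirectedP : ∀ {ℓ'} → Pred A ℓ' → Set (a ⊔ r ⊔ ℓ')
  DirectedP D = (∃[ d ] D d) × (∀ x y → D x → D y → ∃[ z ] (D z × x ≤ z × y ≤ z))

  IsSup : ∀ {ℓ'} → Pred A ℓ' → A → Set (a ⊔ r ⊔ ℓ')
  IsSup D s = (∀ x → D x → x ≤ s) × (∀ u → (∀ x → D x → x ≤ u) → s ≤ u)

  IsDcpo : Set (a ⊔ r ⊔ lsuc ℓ)
  IsDcpo = ∀ (D : Pred A ℓ) → DirectedP D → ∃[ s ] IsSup D s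

  _≪_ : A → A → Set (a ⊔ r ⊔ lsuc ℓ)
  x ≪ y = ∀ (D : Pred A ℓ) → DirectedP D → ∀ s → IsSup D s → y ≤ s →
          ∃[ d ] (D d × x ≤ d)

  ContinuousDcpo : Set (a ⊔ r ⊔ lsuc ℓ)
  ContinuousDcpo = IsDcpo × (∀ x → DirectedP (λ y → y ≪ x) × IsSup (λ y → y ≪ x) x)

  AlgebraicDcpo : Set (a ⊔ r ⊔ lsuc ℓ)
  AlgebraicDcpo = IsDcpo × (∀ x → DirectedP (λ y → y ≪ y × y ≤ x) ×
                                  IsSup (λ y → y ≪ y × y ≤ x) x)

-- X̃ as a dcpo (subsets of X̃ quantified over at the level of its carrier)
module TildeDcpo (X : Space) = DcpoNotions (SpaceNotions._⊆̃_ X) (lsuc 0ℓ)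

-- Forward: for A ∈ X̃, the points a approximating some x ∈ A (a ≪ x, resp. a compact with
-- a ⊑ x) form a directed set.  This goes by induction on the d-closure: an approximation of x
-- persists on an open neighbourhood of x, which meets the union of any directed family whose
-- supremum contains x, so it can be pushed into a member of the family.  The ideals ↓a of these
-- points are way below A in X̃ and have supremum A, so they witness that X̃ is continuous
-- (algebraic).  Backward: then the way-below relation of X̃ interpolates, and again by
-- induction on the d-closure every B ≪ C in X̃ lies inside ↓c for some c ∈ C.  For C = ↓x this
-- turns the approximants of ↓x in X̃ into a directed set of approximants of x converging to x,
-- because ↓a ≪ ↓x in X̃ implies a ≪ x in X.

module Submission where

open import Defs
open import Level using (Level; _⊔_; 0ℓ; Lift; lift; lower) renaming (suc to lsuc)
open import Data.Product using (_×_; Σ; _,_; proj₁; proj₂; ∃-syntax)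
open import Relation.Nullary using (¬_)
open import Relation.Nullary.Decidable using (True; toWitness; fromWitness)
open import Relation.Unary using (Pred; _⊆_)
open import Relation.Binary.Definitions using (Reflexive; Transitive)
open import Relation.Binary.PropositionalEquality using (_≡_; refl)
open import Function.Bundles using (_⇔_; mk⇔)
open import Axiom.ExcludedMiddle using (ExcludedMiddle)
open import Axiom.DoubleNegationElimination using (em⇒dne)

module Classical (lem : ∀ {ℓ} → ExcludedMiddle ℓ) where

  dne : ∀ {ℓ} {P : Set ℓ} → ¬ ¬ P → P
  dne = em⇒dne lem

  -- Excluded middle makes every proposition equivalent to one in Set (the
  -- truth of its decision).  This impredicativity is what lets closures and
  -- suprema of large families be formed as subsets in Pred Carrier 0ℓ.
  Small : ∀ {ℓ} → Set ℓ → Set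
  Small P = True (lem {P = P})

  small : ∀ {ℓ} {P : Set ℓ} → P → Small P
  small = fromWitness

  unsmall : ∀ {ℓ} {P : Set ℓ} → Small P → P
  unsmall = toWitness

  resize : ∀ {a ℓ} {A : Set a} → Pred A ℓ → Pred A a
  resize P x = Lift _ (Small (P x))

module DirectedSubsets {a r} {A : Set a} {_≤_ : A → A → Set r}
                       (≤-trans : Transitive _≤_) where
  open DcpoNotions _≤_ a using (DirectedP; IsSup)

  cofinal-directed : ∀ {ℓ ℓ'} {P : Pred A ℓ} {Q : Pred A ℓ'} → DirectedP P → P ⊆ Q →
                     (∀ {y} → Q y → ∃[ x ] (P x × y ≤ x)) → DirectedP Q
  cofinal-directed ((x , Px) , P-dir) P⊆Q Q≤P = (x , P⊆Q Px) , λ y₁ y₂ Qy₁ Qy₂ →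
    let (x₁ , Px₁ , y₁≤x₁) = Q≤P Qy₁
        (x₂ , Px₂ , y₂≤x₂) = Q≤P Qy₂
        (z , Pz , x₁≤z , x₂≤z) = P-dir x₁ x₂ Px₁ Px₂
    in z , P⊆Q Pz , ≤-trans y₁≤x₁ x₁≤z , ≤-trans y₂≤x₂ x₂≤z

  IsSup-superset : ∀ {ℓ ℓ'} {P : Pred A ℓ} {Q : Pred A ℓ'} {s} → IsSup P s → P ⊆ Q →
                   (∀ {y} → Q y → y ≤ s) → IsSup Q s
  IsSup-superset (_ , least) P⊆Q Q≤s = (λ _ Qy → Q≤s Qy) , λ u ub → least u λ x Px → ub x (P⊆Q Px)

module WayBelow (lem : ∀ {ℓ} → ExcludedMiddle ℓ)
                {a r} {A : Set a} {_≤_ : A → A → Set r}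
                (≤-refl : Reflexive _≤_) (≤-trans : Transitive _≤_) where
  open Classical lem
  open DcpoNotions _≤_ a

  ≪⇒≤ : ∀ {x y} → x ≪ y → x ≤ y
  ≪⇒≤ {y = y} x≪y with x≪y (_≡ y) singleton-directed y singleton-sup ≤-refl
    where
      singleton-directed : DirectedP (_≡ y)
      singleton-directed = (y , refl) , λ { _ _ refl refl → y , refl , ≤-refl , ≤-refl }
      singleton-sup : IsSup (_≡ y) y
      singleton-sup = (λ { _ refl → ≤-refl }) , λ u ub → ub y refl
  ... | _ , refl , x≤y = x≤y

  ≤-≪-trans : ∀ {x y z} → x ≤ y → y ≪ z → x ≪ z
  ≤-≪-trans x≤y y≪z D D-dir s s-sup z≤s =
    let (d , Dd , y≤d) = y≪z D D-dir s s-sup z≤s in d , Dd , ≤-trans x≤y y≤d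

  ≪-≤-trans : ∀ {x y z} → x ≪ y → y ≤ z → x ≪ z
  ≪-≤-trans x≪y y≤z D D-dir s s-sup z≤s = x≪y D D-dir s s-sup (≤-trans y≤z z≤s)

  resize-directed : ∀ {ℓ} {P : Pred A ℓ} → DirectedP P → DirectedP (resize P)
  resize-directed ((x , Px) , P-dir) = (x , lift (small Px)) , λ x₁ x₂ Px₁ Px₂ →
    let (z , Pz , x₁≤z , x₂≤z) = P-dir x₁ x₂ (unsmall (lower Px₁)) (unsmall (lower Px₂))
    in z , lift (small Pz) , x₁≤z , x₂≤z

  resize-sup : ∀ {ℓ} {P : Pred A ℓ} {s} → IsSup P s → IsSup (resize P) s
  resize-sup (upper , least) =
    (λ x Px → upper x (unsmall (lower Px))) , λ u ub → least u λ x Px → ub x (lift (small Px))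

  Interpolative : Set (a ⊔ r ⊔ lsuc a)
  Interpolative = ∀ x z → x ≪ z → ∃[ y ] (x ≪ y × y ≪ z)

  continuous⇒interpolative : ContinuousDcpo → Interpolative
  continuous⇒interpolative (_ , approx) x z x≪z =
    let (y , Dy , x≤y) = x≪z (resize D) (resize-directed D-directed) z (resize-sup D-sup) ≤-refl
        (w , y≪w , w≪z) = unsmall (lower Dy)
    in w , ≤-≪-trans x≤y y≪w , w≪z
    where
      D : Pred A _
      D y = ∃[ w ] (y ≪ w × w ≪ z)

      D-directed : DirectedP D
      D-directed =
        let ((w , w≪z) , _) = proj₁ (approx z)
            ((y , y≪w) , _) = proj₁ (approx w)
        in (y , w , y≪w , w≪z) , λ y₁ y₂ (w₁ , y₁≪w₁ , w₁≪z) (w₂ , y₂≪w₂ , w₂≪z) →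
          let (w₃ , w₃≪z , w₁≤w₃ , w₂≤w₃) = proj₂ (proj₁ (approx z)) w₁ w₂ w₁≪z w₂≪z
              (y₃ , y₃≪w₃ , y₁≤y₃ , y₂≤y₃) =
                proj₂ (proj₁ (approx w₃)) y₁ y₂ (≪-≤-trans y₁≪w₁ w₁≤w₃) (≪-≤-trans y₂≪w₂ w₂≤w₃)
          in y₃ , (w₃ , y₃≪w₃ , w₃≪z) , y₁≤y₃ , y₂≤y₃

      D-sup : IsSup D z
      D-sup = (λ y (w , y≪w , w≪z) → ≤-trans (≪⇒≤ y≪w) (≪⇒≤ w≪z)) ,
              λ u ub → proj₂ (proj₂ (approx z)) u λ w w≪z →
                proj₂ (proj₂ (approx w)) u λ y y≪w → ub y (w , y≪w , w≪z)

  algebraic⇒interpolative : AlgebraicDcpo → Interpolative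
  algebraic⇒interpolative (_ , approx) x z x≪z =
    let (K-dir , K-sup) = approx z
        (y , Ky , x≤y) = x≪z _ (resize-directed K-dir) z (resize-sup K-sup) ≤-refl
        (y≪y , y≤z) = unsmall (lower Ky)
    in y , ≤-≪-trans x≤y y≪y , ≪-≤-trans y≪y y≤z

module TildeConstruction (lem : ∀ {ℓ} → ExcludedMiddle ℓ) (X : Space) where
  open Classical lem
  open Space X
  open SpaceNotions X
  open TildeDcpo X using (DirectedP; IsSup; IsDcpo; ContinuousDcpo; AlgebraicDcpo)
    renaming (_≪_ to _≪̃_)

  ⊑-refl : Reflexive _⊑_
  ⊑-refl {x} i x∈i = x , refl , x∈i

  basic-open-upward : ∀ i {x y} → ⟦ i ⟧ x → x ⊑ y → ⟦ i ⟧ y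
  basic-open-upward i x∈i x⊑y with x⊑y i x∈i
  ... | _ , refl , y∈i = y∈i

  ⊑-trans : Transitive _⊑_
  ⊑-trans x⊑y y⊑z i x∈i = y⊑z i (basic-open-upward i x∈i x⊑y)

  ↓-mono : ∀ {x y} → x ⊑ y → ↓ x ⊆ ↓ y
  ↓-mono x⊑y z⊑x = ⊑-trans z⊑x x⊑y

  open-upward : ∀ {U} → Open U → ∀ {x y} → U x → x ⊑ y → U y
  open-upward (i , i⊆U , U⊆i) Ux x⊑y = i⊆U (basic-open-upward i (U⊆i Ux) x⊑y)

  closed-downward : ∀ {C} → IsClosed C → ∀ {x y} → C y → x ⊑ y → C x
  closed-downward (i , i⊆∁C , ∁C⊆i) Cy x⊑y =
    dne λ ¬Cx → i⊆∁C (basic-open-upward i (∁C⊆i ¬Cx) x⊑y) Cy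

  basic-open : ∀ i → Open ⟦ i ⟧
  basic-open i = i , (λ x∈i → x∈i) , (λ x∈i → x∈i)

  ∉closure⇒separated : ∀ {ℓ} {P : Pred Carrier ℓ} {y} → ¬ closure P y →
                       ∃[ i ] (⟦ i ⟧ y × ¬ (∃[ a ] (P a × ⟦ i ⟧ a)))
  ∉closure⇒separated y∉cl =
    dne λ ¬sep → y∉cl λ i y∈i → dne λ i∩P=∅ → ¬sep (i , y∈i , i∩P=∅)

  closed-if-closure : ∀ {ℓ} (P : Pred Carrier ℓ) {Q : Pred Carrier 0ℓ} →
                      Q ⊆ closure P → closure P ⊆ Q → IsClosed Q
  closed-if-closure P Q⊆cl cl⊆Q = open-local _ λ y y∉Q →
    let (i , y∈i , i∩P=∅) = ∉closure⇒separated (λ y∈cl → y∉Q (cl⊆Q y∈cl))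
    in ⟦ i ⟧ , basic-open i , y∈i , λ z∈i Qz → i∩P=∅ (Q⊆cl Qz i z∈i)

  closure-least : ∀ {ℓ} {P : Pred Carrier ℓ} {C} → IsClosed C → P ⊆ C → closure P ⊆ C
  closure-least (i , i⊆∁C , ∁C⊆i) P⊆C y∈cl = dne λ ¬Cy →
    let (a , Pa , a∈i) = y∈cl i (∁C⊆i ¬Cy) in i⊆∁C a∈i (P⊆C Pa)

  Cl : ∀ {ℓ} → Pred Carrier ℓ → Pred Carrier 0ℓ
  Cl P y = Small (closure P y)

  Cl-closed : ∀ {ℓ} (P : Pred Carrier ℓ) → IsClosed (Cl P)
  Cl-closed P = closed-if-closure P unsmall small

  ⊆Cl : ∀ {ℓ} {P : Pred Carrier ℓ} → P ⊆ Cl P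
  ⊆Cl {x = a} Pa = small λ i a∈i → a , Pa , a∈i

  ↓-closed : ∀ x → IsClosed (↓ x)
  ↓-closed x = closed-if-closure (_≡ x) (λ y⊑x → y⊑x) (λ y⊑x → y⊑x)

  ≪⇒⊑ : ∀ {a x} → a ≪ x → a ⊑ x
  ≪⇒⊑ {x = x} a≪x with a≪x (_≡ x) ((x , refl) , λ { _ _ refl refl → x , refl , ⊑-refl , ⊑-refl })
                                    (λ i x∈i → x , refl , x∈i)
  ... | _ , refl , a⊑x = a⊑x

  converges-downward : ∀ {ℓ} {D : Pred Carrier ℓ} {x y} → Converges D y → x ⊑ y → Converges D x
  converges-downward D→y x⊑y i x∈i = D→y i (basic-open-upward i x∈i x⊑y)

  ⊑-≪-trans : ∀ {a b x} → a ⊑ b → b ≪ x → a ≪ x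
  ⊑-≪-trans a⊑b b≪x D D-dir D→x =
    let (d , Dd , b⊑d) = b≪x D D-dir D→x in d , Dd , ⊑-trans a⊑b b⊑d

  ≪-⊑-trans : ∀ {a x y} → a ≪ x → x ⊑ y → a ≪ y
  ≪-⊑-trans a≪x x⊑y D D-dir D→y = a≪x D D-dir (converges-downward D→y x⊑y)

  compact⇒↑-open : IsDirectedSpace → ∀ {a} → Compact a → Open (↑ a)
  compact⇒↑-open (_ , directed-open) {a} a≪a =
    directed-open (↑ a) λ D D-dir y a⊑y D→y → a≪a D D-dir (converges-downward D→y a⊑y)

  ≪-interpolate : ContinuousSpace → ∀ {a x} → a ≪ x → ∃[ b ] (a ≪ b × b ≪ x)
  ≪-interpolate cont {x = x} a≪x =
    let (c , Dc , a⊑c) = a≪x D D-directed D→x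
        (b , b≪x , c≪b) = unsmall Dc
    in b , ⊑-≪-trans a⊑c c≪b , b≪x
    where
      D : Pred Carrier 0ℓ
      D c = Small (∃[ b ] (b ≪ x × c ≪ b))

      D-directed : Directed D
      D-directed =
        let ((b , b≪x) , _) = proj₁ (cont x)
            ((c , c≪b) , _) = proj₁ (cont b)
        in (c , small (b , b≪x , c≪b)) , λ c₁ c₂ Dc₁ Dc₂ →
          let (b₁ , b₁≪x , c₁≪b₁) = unsmall Dc₁
              (b₂ , b₂≪x , c₂≪b₂) = unsmall Dc₂
              (b₃ , b₃≪x , b₁⊑b₃ , b₂⊑b₃) = proj₂ (proj₁ (cont x)) b₁ b₂ b₁≪x b₂≪x
              (c₃ , c₃≪b₃ , c₁⊑c₃ , c₂⊑c₃) =
                proj₂ (proj₁ (cont b₃)) c₁ c₂ (≪-⊑-trans c₁≪b₁ b₁⊑b₃) (≪-⊑-trans c₂≪b₂ b₂⊑b₃)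
          in c₃ , small (b₃ , b₃≪x , c₃≪b₃) , c₁⊑c₃ , c₂⊑c₃

      D→x : Converges D x
      D→x i x∈i =
        let (b , b≪x , b∈i) = proj₂ (cont x) i x∈i
            (c , c≪b , c∈i) = proj₂ (cont b) i b∈i
        in c , small (b , b≪x , c≪b) , c∈i

  ⇑-open : ContinuousSpace → IsDirectedSpace → ∀ b → Open (λ y → Small (b ≪ y))
  ⇑-open cont (_ , directed-open) b = directed-open _ λ D D-dir y b≪y D→y →
    let (c , b≪c , c≪y) = ≪-interpolate cont (unsmall b≪y)
        (d , Dd , c⊑d) = c≪y D D-dir D→y
    in d , Dd , small (≪-⊑-trans b≪c c⊑d)

  -- X̃ is a dcpo

  Tilde⊆Γ : ∀ {A} → InTilde A → InΓ A
  Tilde⊆Γ (principal x) = ↓-closed x , x , ⊑-refl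
  Tilde⊆Γ (dirsup _ _ _ _ (S∈Γ , _)) = S∈Γ

  Tilde-closed : (E : Tilde) → IsClosed (proj₁ E)
  Tilde-closed (_ , p) = proj₁ (Tilde⊆Γ p)

  ↓̃ : Carrier → Tilde
  ↓̃ x = ↓ x , principal x

  supΓ⊆closure : ∀ {ℓ} {𝒟 : Pred (Pred Carrier 0ℓ) ℓ} {S} → DirectedΓ 𝒟 → IsSupΓ 𝒟 S →
                 S ⊆ closure (λ z → ∃[ A ] (𝒟 A × A z))
  supΓ⊆closure {𝒟 = 𝒟} (⊆Γ , (A , 𝒟A) , _) (_ , _ , least) Sy =
    let (z , Az) = proj₂ (⊆Γ A 𝒟A)
    in unsmall (least (Cl ⋃𝒟) (Cl-closed ⋃𝒟 , z , ⊆Cl (A , 𝒟A , Az))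
                      (λ B 𝒟B Bx → ⊆Cl (B , 𝒟B , Bx)) Sy)
    where
      ⋃𝒟 : Pred Carrier _
      ⋃𝒟 z = ∃[ A ] (𝒟 A × A z)

  ⋃ : ∀ {ℓ} → Pred Tilde ℓ → Pred Carrier _
  ⋃ D z = ∃[ E ] (D E × proj₁ E z)

  module _ {ℓ} (D : Pred Tilde ℓ) (D-dir : DirectedP D) where
    private
      𝒟 : Pred (Pred Carrier 0ℓ) 0ℓ
      𝒟 A = Small (Σ (InTilde A) λ p → D (A , p))

      𝒟-directed : DirectedΓ 𝒟
      𝒟-directed =
        let ((A , p) , DA) = proj₁ D-dir
        in (λ _ 𝒟A → Tilde⊆Γ (proj₁ (unsmall 𝒟A))) , (A , small (p , DA)) , λ A B 𝒟A 𝒟B →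
          let (p , DA) = unsmall 𝒟A
              (q , DB) = unsmall 𝒟B
              ((C , r) , DC , A⊆C , B⊆C) = proj₂ D-dir (A , p) (B , q) DA DB
          in C , small (r , DC) , A⊆C , B⊆C

      Cl⋃-isSupΓ : IsSupΓ 𝒟 (Cl (⋃ D))
      Cl⋃-isSupΓ =
        let ((A , p) , DA) = proj₁ D-dir
            (z , Az) = proj₂ (Tilde⊆Γ p)
        in (Cl-closed (⋃ D) , z , ⊆Cl ((A , p) , DA , Az)) ,
           (λ A 𝒟A Az → let (p , DA) = unsmall 𝒟A in ⊆Cl ((A , p) , DA , Az)) ,
           λ C C∈Γ ub y∈Cl → closure-least (proj₁ C∈Γ)
             (λ { ((A , p) , DA , Az) → ub A (small (p , DA)) Az }) (unsmall y∈Cl)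

    ⨆ : Tilde
    ⨆ = Cl (⋃ D) , dirsup 𝒟 𝒟-directed (λ _ 𝒟A → proj₁ (unsmall 𝒟A)) _ Cl⋃-isSupΓ

    ⨆-isSup : IsSup D ⨆
    ⨆-isSup = (λ E DE Ez → ⊆Cl (E , DE , Ez)) , λ u ub y∈Cl →
      closure-least (Tilde-closed u) (λ { (E , DE , Ez) → ub E DE Ez }) (unsmall y∈Cl)

    sup⊆closure : ∀ s → IsSup D s → proj₁ s ⊆ closure (⋃ D)
    sup⊆closure s (_ , least) y∈s = unsmall (least ⨆ (proj₁ ⨆-isSup) y∈s)

  isDcpo : IsDcpo
  isDcpo D D-dir = ⨆ D D-dir , ⨆-isSup D D-dir

  -- _⊆̃_ and _≪̃_ only look at first projections, so their Tilde arguments can never be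
  -- inferred by unification and are passed explicitly below.
  open WayBelow lem {_≤_ = _⊆̃_} (λ z∈A → z∈A) (λ A⊆B B⊆C z∈A → B⊆C (A⊆B z∈A))
    using (Interpolative; continuous⇒interpolative; algebraic⇒interpolative)
    renaming (≪⇒≤ to ≪̃⇒⊆̃; ≤-≪-trans to ⊆̃-≪̃-trans; ≪-≤-trans to ≪̃-⊆̃-trans)
  open DirectedSubsets {_≤_ = _⊆̃_} (λ A⊆B B⊆C z∈A → B⊆C (A⊆B z∈A))

  principals : ∀ {ℓ} → Pred Carrier ℓ → Pred Tilde _
  principals P E = ∃[ a ] (P a × E ≡ ↓̃ a)

  principals-directed : ∀ {ℓ} {P : Pred Carrier ℓ} → Directed P → DirectedP (principals P)
  principals-directed ((a , Pa) , P-dir) = (↓̃ a , a , Pa , refl) , λ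
    { _ _ (a₁ , Pa₁ , refl) (a₂ , Pa₂ , refl) →
        let (a₃ , Pa₃ , a₁⊑a₃ , a₂⊑a₃) = P-dir a₁ a₂ Pa₁ Pa₂
        in ↓̃ a₃ , (a₃ , Pa₃ , refl) , ↓-mono a₁⊑a₃ , ↓-mono a₂⊑a₃ }

  interior-↑⇒≪̃ : ∀ {a x U} → Open U → U x → U ⊆ ↑ a → (C : Tilde) → proj₁ C x → ↓̃ a ≪̃ C
  interior-↑⇒≪̃ (i , i⊆U , U⊆i) Ux U⊆↑a C Cx D D-dir s s-sup C⊆s =
    let (z , (E , DE , Ez) , z∈i) = sup⊆closure D D-dir s s-sup (C⊆s Cx) i (U⊆i Ux)
    in E , DE , λ b⊑a → closed-downward (Tilde-closed E) Ez (⊑-trans b⊑a (U⊆↑a (i⊆U z∈i)))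

  compact⇒↓̃-compact : IsDirectedSpace → ∀ {a} → Compact a → ↓̃ a ≪̃ ↓̃ a
  compact⇒↓̃-compact ds a≪a = interior-↑⇒≪̃ (compact⇒↑-open ds a≪a) ⊑-refl (λ a⊑y → a⊑y) (↓̃ _) ⊑-refl

  ↓̃-reflects-≪ : ∀ {a x} → ↓̃ a ≪̃ ↓̃ x → a ≪ x
  ↓̃-reflects-≪ {a} {x} ↓a≪↓x D D-dir D→x
    with ↓a≪↓x (principals D) ↓D-directed (⨆ _ ↓D-directed) (⨆-isSup _ ↓D-directed) ↓x⊆⨆↓D
    where
      ↓D-directed : DirectedP (principals D)
      ↓D-directed = principals-directed D-dir

      ↓x⊆⨆↓D : ↓̃ x ⊆̃ ⨆ _ ↓D-directed
      ↓x⊆⨆↓D = closed-downward (Tilde-closed (⨆ _ ↓D-directed)) (small λ i x∈i →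
        let (d , Dd , d∈i) = D→x i x∈i in d , (↓̃ d , (d , Dd , refl) , ⊑-refl) , d∈i)
  ... | _ , (d , Dd , refl) , ↓a⊆↓d = d , Dd , ↓a⊆↓d ⊑-refl

  -- From X to X̃

  -- R abstracts the two ways a point approximates another: a ≪ x, and "a compact and a ⊑ x".
  module FromApproximation
    (R : Carrier → Carrier → Set₁)
    (R-approximates : ∀ x → Directed (λ a → R a x) × Converges (λ a → R a x) x)
    (R-nbhd : ∀ {a x} → R a x → Σ (Pred Carrier 0ℓ) λ U → Open U × U x × U ⊆ R a)
    (R⇒⊑ : ∀ {a x} → R a x → a ⊑ x) where

    R-upward : ∀ {a x y} → R a x → x ⊑ y → R a y
    R-upward Rax x⊑y =
      let (U , U-open , Ux , U⊆Ra) = R-nbhd Rax in U⊆Ra (open-upward U-open Ux x⊑y)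

    Approximants : Pred Carrier 0ℓ → Pred Carrier (lsuc 0ℓ)
    Approximants A a = ∃[ x ] (A x × R a x)

    Approximants-mono : ∀ {A B : Pred Carrier 0ℓ} → A ⊆ B → Approximants A ⊆ Approximants B
    Approximants-mono A⊆B (x , Ax , Rax) = x , A⊆B Ax , Rax

    approximants-supΓ : ∀ {ℓ} {𝒟 : Pred (Pred Carrier 0ℓ) ℓ} {S} → DirectedΓ 𝒟 → IsSupΓ 𝒟 S →
                        ∀ {a} → Approximants S a → ∃[ A ] (𝒟 A × Approximants A a)
    approximants-supΓ 𝒟-dir S-sup (x , Sx , Rax) =
      let (U , (i , i⊆U , U⊆i) , Ux , U⊆Ra) = R-nbhd Rax
          (z , (A , 𝒟A , Az) , z∈i) = supΓ⊆closure 𝒟-dir S-sup Sx i (U⊆i Ux)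
      in A , 𝒟A , z , Az , U⊆Ra (i⊆U z∈i)

    approximants-pairwise : ∀ {A} → InTilde A → ∀ a₁ a₂ → Approximants A a₁ → Approximants A a₂ →
                            ∃[ a₃ ] (Approximants A a₃ × a₁ ⊑ a₃ × a₂ ⊑ a₃)
    approximants-pairwise (principal x) a₁ a₂ (x₁ , x₁⊑x , Ra₁x₁) (x₂ , x₂⊑x , Ra₂x₂) =
      let (a₃ , Ra₃x , a₁⊑a₃ , a₂⊑a₃) =
            proj₂ (proj₁ (R-approximates x)) a₁ a₂ (R-upward Ra₁x₁ x₁⊑x) (R-upward Ra₂x₂ x₂⊑x)
      in a₃ , (x , ⊑-refl , Ra₃x) , a₁⊑a₃ , a₂⊑a₃
    approximants-pairwise (dirsup 𝒟 𝒟-dir 𝒟⊆X̃ S S-sup) a₁ a₂ Sa₁ Sa₂ =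
      let (A₁ , 𝒟A₁ , A₁a₁) = approximants-supΓ 𝒟-dir S-sup Sa₁
          (A₂ , 𝒟A₂ , A₂a₂) = approximants-supΓ 𝒟-dir S-sup Sa₂
          (C , 𝒟C , A₁⊆C , A₂⊆C) = proj₂ (proj₂ 𝒟-dir) A₁ A₂ 𝒟A₁ 𝒟A₂
          (a₃ , Ca₃ , a₁⊑a₃ , a₂⊑a₃) =
            approximants-pairwise (𝒟⊆X̃ C 𝒟C) a₁ a₂
              (Approximants-mono A₁⊆C A₁a₁) (Approximants-mono A₂⊆C A₂a₂)
      in a₃ , Approximants-mono (proj₁ (proj₂ S-sup) C 𝒟C) Ca₃ , a₁⊑a₃ , a₂⊑a₃

    approximants-directed : ∀ {A} → InTilde A → Directed (Approximants A)
    approximants-directed p =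
      let (x , Ax) = proj₂ (Tilde⊆Γ p)
          (a , Rax) = proj₁ (proj₁ (R-approximates x))
      in (a , x , Ax , Rax) , approximants-pairwise p

    basis : Pred Carrier 0ℓ → Pred Tilde (lsuc 0ℓ)
    basis A = principals (Approximants A)

    basis-directed : ∀ {A} → InTilde A → DirectedP (basis A)
    basis-directed p = principals-directed (approximants-directed p)

    basis-sup : ∀ {A} (p : InTilde A) → IsSup (basis A) (A , p)
    basis-sup {A} p = upper , least
      where
        upper : ∀ E → basis A E → E ⊆̃ (A , p)
        upper _ (a , (x , Ax , Rax) , refl) b⊑a =
          closed-downward (Tilde-closed (A , p)) Ax (⊑-trans b⊑a (R⇒⊑ Rax))

        least : ∀ u → (∀ E → basis A E → E ⊆̃ u) → (A , p) ⊆̃ u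
        least u ub {y} Ay = dne λ y∉u →
          let (i , i⊆∁u , ∁u⊆i) = Tilde-closed u
              (a , Ray , a∈i) = proj₂ (R-approximates y) i (∁u⊆i y∉u)
          in i⊆∁u a∈i (ub (↓̃ a) (a , (y , Ay , Ray) , refl) ⊑-refl)

    basis⊆≪̃ : ∀ {A} (p : InTilde A) → basis A ⊆ (_≪̃ (A , p))
    basis⊆≪̃ p (a , (x , Ax , Rax) , refl) =
      let (U , U-open , Ux , U⊆Ra) = R-nbhd Rax
      in interior-↑⇒≪̃ U-open Ux (λ Uy → R⇒⊑ (U⊆Ra Uy)) (_ , p) Ax

    ≪̃⇒⊆basis : ∀ {A} (p : InTilde A) {B} → B ≪̃ (A , p) → ∃[ E ] (basis A E × B ⊆̃ E)
    ≪̃⇒⊆basis {A} p B≪A =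
      B≪A (basis A) (basis-directed p) (A , p) (basis-sup p) (λ z∈A → z∈A)

    continuousDcpo : ContinuousDcpo
    continuousDcpo = isDcpo , λ (A , p) →
      cofinal-directed (basis-directed p) (basis⊆≪̃ p) (λ {B} → ≪̃⇒⊆basis p {B}) ,
      IsSup-superset {s = A , p} (basis-sup p) (basis⊆≪̃ p) λ {B} → ≪̃⇒⊆̃ {B} {A , p}

    algebraicDcpo : (∀ {a x} → R a x → R a a) → AlgebraicDcpo
    algebraicDcpo R-refl = isDcpo , λ (A , p) →
      cofinal-directed (basis-directed p) (basis⊆compact p)
        (λ {B} (B≪B , B⊆A) → ≪̃⇒⊆basis p {B} (≪̃-⊆̃-trans {B} {B} {A , p} B≪B B⊆A)) ,
      IsSup-superset {s = A , p} (basis-sup p) (basis⊆compact p) proj₂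
      where
        basis⊆compact : ∀ {A} (p : InTilde A) → basis A ⊆ λ E → E ≪̃ E × E ⊆̃ (A , p)
        basis⊆compact p Ea@(a , (x , Ax , Rax) , refl) =
          basis⊆≪̃ (principal a) (a , (a , ⊑-refl , R-refl Rax) , refl) , proj₁ (basis-sup p) _ Ea

  continuousSpace⇒continuousDcpo : IsDirectedSpace → ContinuousSpace → ContinuousDcpo
  continuousSpace⇒continuousDcpo ds cont = FromApproximation.continuousDcpo _≪_ cont ≪-nbhd ≪⇒⊑
    where
      ≪-nbhd : ∀ {a x} → a ≪ x → Σ (Pred Carrier 0ℓ) λ U → Open U × U x × U ⊆ (a ≪_)
      ≪-nbhd a≪x =
        let (b , a≪b , b≪x) = ≪-interpolate cont a≪x
        in (λ y → Small (b ≪ y)) , ⇑-open cont ds b , small b≪x ,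
           λ b≪y → ≪-⊑-trans a≪b (≪⇒⊑ (unsmall b≪y))

  algebraicSpace⇒algebraicDcpo : IsDirectedSpace → AlgebraicSpace → AlgebraicDcpo
  algebraicSpace⇒algebraicDcpo ds alg =
    FromApproximation.algebraicDcpo (λ a x → Compact a × a ⊑ x) alg
      (λ { {a} (a≪a , a⊑x) → ↑ a , compact⇒↑-open ds a≪a , a⊑x , λ a⊑y → a≪a , a⊑y })
      proj₂ (λ (a≪a , _) → a≪a , ⊑-refl)

  -- From X̃ to X

  members : Pred (Pred Carrier 0ℓ) 0ℓ → Pred Tilde (lsuc 0ℓ)
  members 𝒟 E = Lift (lsuc 0ℓ) (𝒟 (proj₁ E))

  members-directed : ∀ {𝒟} → DirectedΓ 𝒟 → (∀ A → 𝒟 A → InTilde A) → DirectedP (members 𝒟)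
  members-directed (_ , (A , 𝒟A) , 𝒟-dir) 𝒟⊆X̃ =
    ((A , 𝒟⊆X̃ A 𝒟A) , lift 𝒟A) , λ E₁ E₂ (lift 𝒟E₁) (lift 𝒟E₂) →
      let (C , 𝒟C , E₁⊆C , E₂⊆C) = 𝒟-dir _ _ 𝒟E₁ 𝒟E₂ in (C , 𝒟⊆X̃ C 𝒟C) , lift 𝒟C , E₁⊆C , E₂⊆C

  members-sup : ∀ {𝒟 S} → (∀ A → 𝒟 A → InTilde A) → IsSupΓ 𝒟 S → (p : InTilde S) →
                IsSup (members 𝒟) (S , p)
  members-sup 𝒟⊆X̃ (_ , upper , least) _ =
    (λ E (lift 𝒟E) → upper _ 𝒟E) ,
    λ u ub → least (proj₁ u) (Tilde⊆Γ (proj₂ u)) λ A 𝒟A → ub (A , 𝒟⊆X̃ A 𝒟A) (lift 𝒟A)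

  module _ (interpolative : Interpolative) where

    -- Induction on the d-closure: interpolate B ≪ B' ≪ ⨆𝒟, find a member above B', and recurse.
    ≪̃⇒⊆↓ : ∀ {C} (p : InTilde C) {B} → B ≪̃ (C , p) → ∃[ c ] (C c × proj₁ B ⊆ ↓ c)
    ≪̃⇒⊆↓ (principal x) {B} B≪↓x = x , ⊑-refl , ≪̃⇒⊆̃ {B} {↓̃ x} B≪↓x
    ≪̃⇒⊆↓ p@(dirsup 𝒟 𝒟-dir 𝒟⊆X̃ S S-sup) {B} B≪S =
      let (B' , B≪B' , B'≪S) = interpolative B (S , p) B≪S
          ((A , _) , lift 𝒟A , B'⊆A) =
            B'≪S (members 𝒟) (members-directed 𝒟-dir 𝒟⊆X̃) (S , p) (members-sup 𝒟⊆X̃ S-sup p)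
              (λ z∈S → z∈S)
          (c , Ac , B⊆↓c) = ≪̃⇒⊆↓ (𝒟⊆X̃ A 𝒟A) {B} (≪̃-⊆̃-trans {B} {B'} {A , 𝒟⊆X̃ A 𝒟A} B≪B' B'⊆A)
      in c , proj₁ (proj₂ S-sup) A 𝒟A Ac , B⊆↓c

    ≪̃⇒⊆↓≪̃ : ∀ {B C} → B ≪̃ C → ∃[ c ] (proj₁ B ⊆ ↓ c × ↓̃ c ≪̃ C)
    ≪̃⇒⊆↓≪̃ {B} {C} B≪C =
      let (B' , B≪B' , B'≪C) = interpolative B C B≪C
          (c , B'c , B⊆↓c) = ≪̃⇒⊆↓ (proj₂ B') {B} B≪B'
      in c , B⊆↓c , ⊆̃-≪̃-trans {↓̃ c} {B'} {C} (closed-downward (Tilde-closed B') B'c) B'≪C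

  principals-cofinal⇒approximating :
    ∀ {ℓ ℓ'} {𝒬 : Pred Tilde ℓ} {Q : Pred Carrier ℓ'} {x} → DirectedP 𝒬 → IsSup 𝒬 (↓̃ x) →
    (∀ {B} → 𝒬 B → ∃[ c ] (Q c × proj₁ B ⊆ ↓ c)) → (∀ {c} → Q c → 𝒬 (↓̃ c)) →
    Directed Q × Converges Q x
  principals-cofinal⇒approximating {𝒬 = 𝒬} {Q} {x} 𝒬-dir 𝒬-sup 𝒬⊆↓Q Q⊆𝒬 =
    (inhabited , pairwise) , converges
    where
      inhabited : ∃[ c ] Q c
      inhabited = let (c , Qc , _) = 𝒬⊆↓Q (proj₂ (proj₁ 𝒬-dir)) in c , Qc

      pairwise : ∀ c₁ c₂ → Q c₁ → Q c₂ → ∃[ c ] (Q c × c₁ ⊑ c × c₂ ⊑ c)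
      pairwise c₁ c₂ Qc₁ Qc₂ =
        let (B , 𝒬B , ↓c₁⊆B , ↓c₂⊆B) = proj₂ 𝒬-dir _ _ (Q⊆𝒬 Qc₁) (Q⊆𝒬 Qc₂)
            (c , Qc , B⊆↓c) = 𝒬⊆↓Q 𝒬B
        in c , Qc , B⊆↓c (↓c₁⊆B ⊑-refl) , B⊆↓c (↓c₂⊆B ⊑-refl)

      converges : Converges Q x
      converges i x∈i =
        let (z , (B , 𝒬B , Bz) , z∈i) = sup⊆closure 𝒬 𝒬-dir (↓̃ x) 𝒬-sup ⊑-refl i x∈i
            (c , Qc , B⊆↓c) = 𝒬⊆↓Q 𝒬B
        in c , Qc , basic-open-upward i z∈i (B⊆↓c Bz)

  ≪-approximating : ∀ {Q : Pred Carrier 0ℓ} {x} → Directed Q → Converges Q x → Q ⊆ (_≪ x) →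
                    Directed (_≪ x) × Converges (_≪ x) x
  ≪-approximating Q-dir Q→x Q⊆⇓x =
    DirectedSubsets.cofinal-directed ⊑-trans Q-dir Q⊆⇓x (λ a≪x → a≪x _ Q-dir Q→x) ,
    λ i x∈i → let (d , Qd , d∈i) = Q→x i x∈i in d , Q⊆⇓x Qd , d∈i

  continuousDcpo⇒continuousSpace : ContinuousDcpo → ContinuousSpace
  continuousDcpo⇒continuousSpace X̃-cont@(_ , approx) x =
    let (Q-dir , Q→x) = principals-cofinal⇒approximating {Q = Q} (proj₁ (approx (↓̃ x)))
                          (proj₂ (approx (↓̃ x))) (λ {B} → cofinal {B}) unsmall
    in ≪-approximating Q-dir Q→x λ ↓a≪↓x → ↓̃-reflects-≪ (unsmall ↓a≪↓x)
    where
      Q : Pred Carrier 0ℓ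
      Q c = Small (↓̃ c ≪̃ ↓̃ x)

      cofinal : ∀ {B} → B ≪̃ ↓̃ x → ∃[ c ] (Q c × proj₁ B ⊆ ↓ c)
      cofinal {B} B≪x =
        let (c , B⊆↓c , c≪x) = ≪̃⇒⊆↓≪̃ (continuous⇒interpolative X̃-cont) {B} {↓̃ x} B≪x
        in c , small c≪x , B⊆↓c

  algebraicDcpo⇒algebraicSpace : IsDirectedSpace → AlgebraicDcpo → AlgebraicSpace
  algebraicDcpo⇒algebraicSpace ds X̃-alg@(_ , approx) x =
    principals-cofinal⇒approximating (proj₁ (approx (↓̃ x))) (proj₂ (approx (↓̃ x))) (λ {B} → cofinal {B})
      λ (c≪c , c⊑x) → compact⇒↓̃-compact ds c≪c , ↓-mono c⊑x
    where
      cofinal : ∀ {B} → B ≪̃ B × B ⊆̃ ↓̃ x → ∃[ c ] ((Compact c × c ⊑ x) × proj₁ B ⊆ ↓ c)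
      cofinal {B} (B≪B , B⊆↓x) =
        let (c , B⊆↓c , c≪B) = ≪̃⇒⊆↓≪̃ (algebraic⇒interpolative X̃-alg) {B} {B} B≪B
            c≪c = ≪̃-⊆̃-trans {↓̃ c} {B} {↓̃ c} c≪B B⊆↓c
        in c , (↓̃-reflects-≪ c≪c , B⊆↓x (≪̃⇒⊆̃ {↓̃ c} {B} c≪B ⊑-refl)) , B⊆↓c

corollary4p11 : (∀ {ℓ : Level} → ExcludedMiddle ℓ) →
    (X : Space) → SpaceNotions.IsDirectedSpace X →
    (SpaceNotions.ContinuousSpace X ⇔ TildeDcpo.ContinuousDcpo X) ×
    (SpaceNotions.AlgebraicSpace X ⇔ TildeDcpo.AlgebraicDcpo X)
corollary4p11 lem X ds =
  mk⇔ (continuousSpace⇒continuousDcpo ds) continuousDcpo⇒continuousSpace ,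
  mk⇔ (algebraicSpace⇒algebraicDcpo ds) (algebraicDcpo⇒algebraicSpace ds)
  where open TildeConstruction lem X
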